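{- For every base $\mathcal{B}$, all finite sets $M, L\subseteq\mathbb{L}$ and every $l\in\mathbb{L}$: $M\cup L\vdash_{\mathcal{B}} l$ if and only if for every base $\mathcal{X}\supseteq\mathcal{B}$, if $\vdash_{\mathcal{X}} m$ for every $m\in M$, then $L\vdash_{\mathcal{X}} l$.
   Context: Let $\mathbb{C}$ be a denumerable set of contents and $\mathbb{L} = \{c^+, c^- : c\in\mathbb{C}\}$ the set of literals; for a literal $l$, $l^\bot$ denotes its dual ($(c^+)^\bot=c^-$, $(c^-)^\bot=c^+$). The symbol $\bot$ is not a literal. An atomic rule has the form $(L_1\Rightarrow l_1),\ldots,(L_n\Rightarrow l_n)\Rightarrow l$ with $n\ge 0$, $l,l_i\in\mathbb{L}$ and $L_i\subseteq\mathbb{L}$ finite; $\Rightarrow l$ denotes the rule with $n=0$. A base is a (possibly infinite) set of atomic rules; $\mathcal{X}\supseteq\mathcal{B}$ means set inclusion of bases. Derivability in a base $\mathcal{B}$ is the smallest relation $L\vdash_{\mathcal{B}} l$ between finite sets $L\subseteq\mathbb{L}$ and $l\in\mathbb{L}\cup\{\bot\}$ such that: (REF) if $l\in L$ then $L\vdash_{\mathcal{B}} l$; (APP$_1$) if $(\Rightarrow l)\in\mathcal{B}$ then $L\vdash_{\mathcal{B}} l$ for every $L$; (APP$_2$) if $(L_1\Rightarrow l_1),\ldots,(L_n\Rightarrow l_n)\Rightarrow l\in\mathcal{B}$ and $L\cup L_i\vdash_{\mathcal{B}} l_i$ for $i=1,\ldots,n$, then $L\vdash_{\mathcal{B}} l$;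 (ABS) if $L\vdash_{\mathcal{B}} m$ and $L\vdash_{\mathcal{B}} m^\bot$ for some $m\in\mathbb{L}$, then $L\vdash_{\mathcal{B}}\bot$; (DM) if $L\cup\{m\}\vdash_{\mathcal{B}}\bot$ for $m\in\mathbb{L}$, then $L\vdash_{\mathcal{B}} m^\bot$. We write $\vdash_{\mathcal{B}} l$ for $\emptyset\vdash_{\mathcal{B}} l$. -}

module Defs where

open import Data.Nat using (ℕ)
open import Data.Bool using (Bool; true; false; not)
open import Data.List using (List; []; _++_)
open import Data.List.Membership.Propositional using (_∈_)
open import Data.List.Relation.Unary.All using (All)
open import Data.Product using (_×_; proj₁; proj₂)
open import Level using (Level; suc)

Content : Set
Content = ℕ

-- Literals c⁺ (sign = true) and c⁻ (sign = false).
record Literal : Set where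
  constructor lit
  field
    sign    : Bool
    content : Content

open Literal public

_ᵈ : Literal → Literal
(lit s c) ᵈ = lit (not s) c

data Goal : Set where
  ⟨_⟩ : Literal → Goal
  ⊥g  : Goal

-- finite sets of literals, represented as lists (membership = _∈_)
LitSet : Set
LitSet = List Literal

-- atomic rule (L₁ ⇒ l₁), … ,(Lₙ ⇒ lₙ) ⇒ l
record Rule : Set where
  constructor _⇒ʳ_
  field
    premises   : List (LitSet × Literal)
    conclusion : Literal

open Rule public

-- a (possibly infinite) base: a set of atomic rules, given as a predicate
Base : Set₁
Base = Rule → Set

_⊇ᴮ_ : Base → Base → Set
X ⊇ᴮ B = ∀ r → B r → X r

data _⊢[_]_ : LitSet → Base → Goal → Set₁ where
  REF  : ∀ {B L l} → l ∈ L → L ⊢[ B ] ⟨ l ⟩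
  APP₁ : ∀ {B L l} → B ([] ⇒ʳ l) → L ⊢[ B ] ⟨ l ⟩
  APP₂ : ∀ {B L l} {ps : List (LitSet × Literal)} → B (ps ⇒ʳ l) →
         All (λ p → (L ++ proj₁ p) ⊢[ B ] ⟨ proj₂ p ⟩) ps →
         L ⊢[ B ] ⟨ l ⟩
  ABS  : ∀ {B L} m → L ⊢[ B ] ⟨ m ⟩ → L ⊢[ B ] ⟨ m ᵈ ⟩ → L ⊢[ B ] ⊥g
  DM   : ∀ {B L} m → (L ++ (m Data.List.∷ [])) ⊢[ B ] ⊥g → L ⊢[ B ] ⟨ m ᵈ ⟩

{-# OPTIONS --safe #-}
-- Forward direction: a derivation in B stays valid in any X ⊇ B, and each use of a
-- hypothesis m ∈ M can be replaced by the derivation of ⊢_X m (admissibility of cut).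
-- Backward direction: instantiate X with B plus the axioms ⇒ m for m ∈ M; in the
-- context M ∪ L every application of such an axiom becomes an instance of REF.
module Submission where

open import Defs
open import Data.List using (List; []; _++_; _∷_)
open import Data.List.Membership.Propositional using (_∈_)
open import Data.List.Membership.Propositional.Properties using (∈-++⁺ʳ; ∈-++⁻)
open import Data.List.Relation.Binary.Subset.Propositional using (_⊆_)
open import Data.List.Relation.Binary.Subset.Propositional.Properties
  using (⊆-trans; xs⊆xs++ys; xs⊆ys++xs; ++⁺ˡ)
open import Data.List.Relation.Unary.All using (All; []; _∷_)
open import Data.Product using (_×_; proj₁; proj₂)
open import Data.Sum using (inj₁; inj₂)
open import Function.Bundles using (_⇔_; mk⇔)

Premises⊢ : LitSet → Base → List (LitSet × Literal) → Set₁
Premises⊢ K X ps = All (λ p → (K ++ proj₁ p) ⊢[ X ] ⟨ proj₂ p ⟩) ps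

mutual
  weaken : ∀ {X K K' g} → K ⊆ K' → K ⊢[ X ] g → K' ⊢[ X ] g
  weaken K⊆K' (REF l∈K)   = REF (K⊆K' l∈K)
  weaken K⊆K' (APP₁ r)    = APP₁ r
  weaken K⊆K' (APP₂ r ds) = APP₂ r (weaken-premises K⊆K' ds)
  weaken K⊆K' (ABS m d e) = ABS m (weaken K⊆K' d) (weaken K⊆K' e)
  weaken K⊆K' (DM m d)    = DM m (weaken (++⁺ˡ (m ∷ []) K⊆K') d)

  weaken-premises : ∀ {X K K' ps} → K ⊆ K' → Premises⊢ K X ps → Premises⊢ K' X ps
  weaken-premises K⊆K' []                  = []
  weaken-premises K⊆K' (_∷_ {x = p} d ds) =
    weaken (++⁺ˡ (proj₁ p) K⊆K') d ∷ weaken-premises K⊆K' ds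

_⊢[_]*_ : LitSet → Base → LitSet → Set₁
K' ⊢[ X ]* K = ∀ {l} → l ∈ K → K' ⊢[ X ] ⟨ l ⟩

⊢*-++⁺ˡ : ∀ {X K K'} Li → K' ⊢[ X ]* K → (K' ++ Li) ⊢[ X ]* (K ++ Li)
⊢*-++⁺ˡ {K = K} {K'} Li K'⊢K l∈K++Li with ∈-++⁻ K l∈K++Li
... | inj₁ l∈K  = weaken (xs⊆xs++ys K' Li) (K'⊢K l∈K)
... | inj₂ l∈Li = REF (∈-++⁺ʳ K' l∈Li)

mutual
  cut : ∀ {B X K K' g} → X ⊇ᴮ B → K' ⊢[ X ]* K → K ⊢[ B ] g → K' ⊢[ X ] g
  cut X⊇B K'⊢K (REF l∈K)   = K'⊢K l∈K
  cut X⊇B K'⊢K (APP₁ r)    = APP₁ (X⊇B _ r)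
  cut X⊇B K'⊢K (APP₂ r ds) = APP₂ (X⊇B _ r) (cut-premises X⊇B K'⊢K ds)
  cut X⊇B K'⊢K (ABS m d e) = ABS m (cut X⊇B K'⊢K d) (cut X⊇B K'⊢K e)
  cut X⊇B K'⊢K (DM m d)    = DM m (cut X⊇B (⊢*-++⁺ˡ (m ∷ []) K'⊢K) d)

  cut-premises : ∀ {B X K K' ps} → X ⊇ᴮ B → K' ⊢[ X ]* K →
                 Premises⊢ K B ps → Premises⊢ K' X ps
  cut-premises X⊇B K'⊢K []                  = []
  cut-premises X⊇B K'⊢K (_∷_ {x = p} d ds) =
    cut X⊇B (⊢*-++⁺ˡ (proj₁ p) K'⊢K) d ∷ cut-premises X⊇B K'⊢K ds

data _withAxioms_ (B : Base) (M : LitSet) : Base where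
  rule  : ∀ {r} → B r → (B withAxioms M) r
  axiom : ∀ {m} → m ∈ M → (B withAxioms M) ([] ⇒ʳ m)

⊇ᴮ-withAxioms : ∀ B M → (B withAxioms M) ⊇ᴮ B
⊇ᴮ-withAxioms B M _ = rule

mutual
  eliminate-axioms : ∀ {B M K g} → M ⊆ K → K ⊢[ B withAxioms M ] g → K ⊢[ B ] g
  eliminate-axioms M⊆K (REF l∈K)             = REF l∈K
  eliminate-axioms M⊆K (APP₁ (rule r))       = APP₁ r
  eliminate-axioms M⊆K (APP₁ (axiom l∈M))    = REF (M⊆K l∈M)
  eliminate-axioms M⊆K (APP₂ (rule r) ds)    = APP₂ r (eliminate-axioms-premises M⊆K ds)
  eliminate-axioms M⊆K (APP₂ (axiom l∈M) ds) = REF (M⊆K l∈M)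
  eliminate-axioms M⊆K (ABS m d e)           =
    ABS m (eliminate-axioms M⊆K d) (eliminate-axioms M⊆K e)
  eliminate-axioms {K = K} M⊆K (DM m d)      =
    DM m (eliminate-axioms (⊆-trans M⊆K (xs⊆xs++ys K (m ∷ []))) d)

  eliminate-axioms-premises : ∀ {B M K ps} → M ⊆ K →
    Premises⊢ K (B withAxioms M) ps → Premises⊢ K B ps
  eliminate-axioms-premises M⊆K [] = []
  eliminate-axioms-premises {K = K} M⊆K (_∷_ {x = p} d ds) =
    eliminate-axioms (⊆-trans M⊆K (xs⊆xs++ys K (proj₁ p))) d
      ∷ eliminate-axioms-premises M⊆K ds

mainTheorem4 : (B : Base) (M L : LitSet) (l : Literal) →
    ((M ++ L) ⊢[ B ] ⟨ l ⟩) ⇔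
    ((X : Base) → X ⊇ᴮ B → (∀ m → m ∈ M → [] ⊢[ X ] ⟨ m ⟩) → L ⊢[ X ] ⟨ l ⟩)
mainTheorem4 B M L l = mk⇔ sound complete
  where
  sound : (M ++ L) ⊢[ B ] ⟨ l ⟩ →
          (X : Base) → X ⊇ᴮ B → (∀ m → m ∈ M → [] ⊢[ X ] ⟨ m ⟩) → L ⊢[ X ] ⟨ l ⟩
  sound d X X⊇B ⊢M = cut X⊇B L⊢M++L d
    where
    L⊢M++L : L ⊢[ X ]* (M ++ L)
    L⊢M++L l∈M++L with ∈-++⁻ M l∈M++L
    ... | inj₁ l∈M = weaken (λ ()) (⊢M _ l∈M)
    ... | inj₂ l∈L = REF l∈L

  complete : ((X : Base) → X ⊇ᴮ B → (∀ m → m ∈ M → [] ⊢[ X ] ⟨ m ⟩) → L ⊢[ X ] ⟨ l ⟩) →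
             (M ++ L) ⊢[ B ] ⟨ l ⟩
  complete h = eliminate-axioms (xs⊆xs++ys M L) (weaken (xs⊆ys++xs L M) L⊢l)
    where
    L⊢l : L ⊢[ B withAxioms M ] ⟨ l ⟩
    L⊢l = h (B withAxioms M) (⊇ᴮ-withAxioms B M) (λ _ m∈M → APP₁ (axiom m∈M))
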